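{- Let $n \ge 2$. Assume that the Graycode numbering minimizes the cyclic wirelength of $Q_n$ among all numberings. Then $\mathrm{cwl}(Q_n) = 2^{2n-2} + 2^{2n-3} - 2^{n-1}$.
   Context: $Q_n$ is the graph on $\{0,1\}^n$ with two vertices adjacent iff they differ in exactly one coordinate. A numbering is a bijection $\eta$ from the vertices of $Q_n$ to $\mathbb{Z}_{2^n}$ (positions on a cycle). The cyclic length of an edge $\{v,w\}$ is $\min(|a|, 2^n - |a|)$ where $a$ is the representative of $\eta(v)-\eta(w)$ in $\{0,\dots,2^n-1\}$; $\mathrm{cwl}(Q_n,\eta)$ is the sum of the cyclic lengths of all edges, and $\mathrm{cwl}(Q_n)$ is the minimum of $\mathrm{cwl}(Q_n,\eta)$ over all numberings. The Graycode numbering is defined recursively: for $Q_2$ the vertices are numbered consecutively around the 4-cycle; having a numbering $1,\dots,2^{n-1}$ of $Q_{n-1}$ along a sequence in which consecutively numbered vertices are adjacent, $Q_n$ consists of two copies of $Q_{n-1}$ (last coordinate $0$ and $1$), the first copy is numbered $1,\dots,2^{n-1}$ as in $Q_{n-1}$ and the second copy is numbered in reverse, the copy of the vertex numbered $k$ receiving the number $2^n+1-k$. -}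

module Defs where

open import Data.Nat using (ℕ; zero; suc; _+_; _*_; _∸_; _^_; _≤_; _⊓_)
open import Data.Nat.DivMod using (_%_)
open import Data.Nat.Properties using (m^n≢0)
open import Data.Bool using (Bool; true; false; if_then_else_; not)
open import Data.Fin using (Fin; toℕ)
open import Data.Vec using (Vec; []; _∷_; lookup; updateAt; init; last)
open import Data.List using (List; []; _∷_; map; _++_; concatMap; allFin)
open import Data.Nat.ListAction using (sum)
open import Data.Product using (Σ; _×_)
open import Function.Bundles using (_⤖_; Bijection)
open import Relation.Binary.PropositionalEquality using (_≡_)

-- Vertices of Q_n : {0,1}^n  (false = 0, true = 1)
Vertex : ℕ → Set
Vertex n = Vec Bool n

allVertices : (n : ℕ) → List (Vertex n)
allVertices zero = [] ∷ []
allVertices (suc n) = map (false ∷_) (allVertices n) ++ map (true ∷_) (allVertices n)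

flipAt : ∀ {n} → Fin n → Vertex n → Vertex n
flipAt i v = updateAt v i not

N : ℕ → ℕ
N n = 2 ^ n

cycLen : (n : ℕ) → ℕ → ℕ → ℕ
cycLen n x y = a ⊓ (N n ∸ a)
  where
  instance _ = m^n≢0 2 n
  a : ℕ
  a = ((x % N n) + N n ∸ (y % N n)) % N n

-- total cyclic wirelength of a position assignment f : V(Q_n) → ℕ (positions mod 2^n).
-- Each edge {v, v with coordinate i flipped} is counted once, from the endpoint
-- having 0 in coordinate i.
cwlOf : (n : ℕ) → (Vertex n → ℕ) → ℕ
cwlOf n f = sum (concatMap edgesAt (allVertices n))
  where
  edgesAt : Vertex n → List ℕ
  edgesAt v = map (λ i → if lookup v i then 0 else cycLen n (f v) (f (flipAt i v))) (allFin n)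

-- A numbering: bijection V(Q_n) → Z_{2^n} (represented by Fin (2^n))
Numbering : ℕ → Set
Numbering n = Vertex n ⤖ Fin (2 ^ n)

cwl : (n : ℕ) → Numbering n → ℕ
cwl n η = cwlOf n (λ v → toℕ (Bijection.to η v))

IsCwl : ℕ → ℕ → Set
IsCwl n m = Σ (Numbering n) (λ η → cwl n η ≡ m) × ((η : Numbering n) → m ≤ cwl n η)

-- Graycode numbering (values 1..2^n), recursive on the last coordinate:
-- copy with last coordinate 0 numbered as in Q_{n-1}, copy with last coordinate 1
-- numbered k ↦ 2^n + 1 - k.  (Q_0 ↦ 1; this yields for Q_2 the consecutive
-- numbering 00↦1, 10↦2, 11↦3, 01↦4 around the 4-cycle.)
gray : (n : ℕ) → Vertex n → ℕ
gray zero _ = 1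
gray (suc n) v = if last v then (2 ^ suc n + 1) ∸ gray n (init v) else gray n (init v)

cwlGray : ℕ → ℕ
cwlGray n = cwlOf n (gray n)

-- The Graycode numbering of Q_{n+1} puts the two copies of Q_n on the two halves of the
-- cycle, the second one mirrored by g ↦ 2^{n+1} + 1 − g.  An edge inside a copy is at most
-- 2^n long, so its cyclic length is its linear length |g − g′|, which the mirror preserves;
-- thus the cyclic wirelength of Q_{n+1}, like its linear wirelength, is twice the linear
-- wirelength W_n of Q_n plus the lengths of the 2^n edges between the copies.  These join g
-- to 2^{n+1} + 1 − g, so their linear lengths are the odd numbers below 2^{n+1}: they add up
-- to 4^n, which gives 2 W_n + 2^n = 4^n, and their cyclic lengths add up to 2 · 4^{n−1}.
-- Hence the Graycode numbering of Q_n (n ≥ 2) has cyclic wirelength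
-- 4^{n−1} − 2^{n−1} + 2 · 4^{n−2}, which is the minimum by hypothesis.
module Submission where

open import Defs
open import Data.Nat using (ℕ; zero; suc; pred; _+_; _*_; _∸_; _^_; _≤_; _<_; _⊓_; _≤?_; z≤n; s≤s; ∣_-_∣; NonZero; >-nonZero)
open import Data.Nat.Properties
open import Data.Nat.DivMod
open import Data.Nat.Tactic.RingSolver using (solve-∀)
open import Algebra.Properties.CommutativeSemigroup +-commutativeSemigroup using (interchange; xy∙z≈xz∙y)
open import Data.Bool using (Bool; true; false; if_then_else_; not)
open import Data.Fin as Fin using (Fin; toℕ; fromℕ; fromℕ<; inject₁)
open import Data.Fin.Properties using (toℕ-fromℕ<; toℕ-injective; toℕ<n)
open import Data.Vec using (Vec; []; _∷_; lookup; updateAt; _∷ʳ_; initLast)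
open import Data.Vec.Properties using (init-∷ʳ; last-∷ʳ)
open import Data.List using (List; []; _∷_; map; _++_; concat; concatMap; allFin; tabulate)
open import Data.List.Properties using (map-++; map-cong; map-∘; map-tabulate)
open import Data.Nat.ListAction using (sum)
open import Data.Nat.ListAction.Properties using (sum-++)
open import Data.Product using (_×_; _,_; proj₁; proj₂; ∃; uncurry)
open import Data.Sum using (inj₁; inj₂)
open import Function using (id; _∘_)
open import Function.Bundles using (mk⤖)
open import Relation.Nullary using (yes; no; contradiction)
open import Relation.Binary.PropositionalEquality

∑ : ℕ → (ℕ → ℕ) → ℕ
∑ zero    f = 0
∑ (suc b) f = ∑ b f + f b

∑-cong : ∀ b {f g : ℕ → ℕ} → (∀ k → k < b → f k ≡ g k) → ∑ b f ≡ ∑ b g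
∑-cong zero    eq = refl
∑-cong (suc b) eq = cong₂ _+_ (∑-cong b (λ k k<b → eq k (m<n⇒m<1+n k<b))) (eq b ≤-refl)

∑-head : ∀ b f → ∑ (suc b) f ≡ f 0 + ∑ b (λ k → f (suc k))
∑-head zero    f = +-comm 0 (f 0)
∑-head (suc b) f = trans (cong (_+ f (suc b)) (∑-head b f)) (+-assoc (f 0) _ _)

∑-reverse : ∀ b f → ∑ b f ≡ ∑ b (λ k → f (b ∸ suc k))
∑-reverse zero    f = refl
∑-reverse (suc b) f = begin
  ∑ b f + f b                           ≡⟨ cong (_+ f b) (∑-reverse b f) ⟩
  ∑ b (λ k → f (b ∸ suc k)) + f b       ≡⟨ +-comm _ (f b) ⟩
  f b + ∑ b (λ k → f (b ∸ suc k))       ≡⟨ ∑-head b (λ k → f (b ∸ k)) ⟨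
  ∑ (suc b) (λ k → f (suc b ∸ suc k))   ∎
  where open ≡-Reasoning

∑-+ : ∀ a b f → ∑ (a + b) f ≡ ∑ a f + ∑ b (λ k → f (a + k))
∑-+ a zero    f = trans (cong (λ c → ∑ c f) (+-identityʳ a)) (sym (+-identityʳ _))
∑-+ a (suc b) f = begin
  ∑ (a + suc b) f                            ≡⟨ cong (λ c → ∑ c f) (+-suc a b) ⟩
  ∑ (a + b) f + f (a + b)                    ≡⟨ cong (_+ f (a + b)) (∑-+ a b f) ⟩
  ∑ a f + ∑ b (λ k → f (a + k)) + f (a + b)  ≡⟨ +-assoc (∑ a f) _ _ ⟩
  ∑ a f + ∑ (suc b) (λ k → f (a + k))        ∎
  where open ≡-Reasoning

odd : ℕ → ℕ
odd k = suc (2 * k)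

∑-odd : ∀ b → ∑ b odd ≡ b * b
∑-odd zero    = refl
∑-odd (suc b) = trans (cong (_+ odd b) (∑-odd b)) (square-suc b)
  where
  square-suc : ∀ b → b * b + suc (2 * b) ≡ suc b * suc b
  square-suc = solve-∀

mirror : ℕ → ℕ → ℕ
mirror B g = 2 * B + 1 ∸ g

∣∸-∸∣ : ∀ {M x y} → x ≤ M → y ≤ M → ∣ M ∸ x - M ∸ y ∣ ≡ ∣ x - y ∣
∣∸-∸∣ {M} {x} {y} x≤M y≤M = begin
  ∣ M ∸ x - M ∸ y ∣                      ≡⟨ ∣m+n-m+o∣≡∣n-o∣ (x + y) _ _ ⟨
  ∣ x + y + (M ∸ x) - x + y + (M ∸ y) ∣  ≡⟨ cong₂ ∣_-_∣ left right ⟩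
  ∣ M + y - M + x ∣                      ≡⟨ ∣m+n-m+o∣≡∣n-o∣ M y x ⟩
  ∣ y - x ∣                              ≡⟨ ∣-∣-comm y x ⟩
  ∣ x - y ∣                              ∎
  where
  open ≡-Reasoning
  left : x + y + (M ∸ x) ≡ M + y
  left = trans (xy∙z≈xz∙y x y (M ∸ x)) (cong (_+ y) (m+[n∸m]≡n x≤M))
  right : x + y + (M ∸ y) ≡ M + x
  right = trans (+-assoc x y _) (trans (cong (x +_) (m+[n∸m]≡n y≤M)) (+-comm x M))

2B+1≡B+[1+B] : ∀ B → 2 * B + 1 ≡ B + suc B
2B+1≡B+[1+B] = solve-∀

mirror-bounds : ∀ B {g} → 1 ≤ g → g ≤ B → B < mirror B g × mirror B g ≤ 2 * B
mirror-bounds B {g} 1≤g g≤B =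
  subst (_≤ mirror B g) (trans (cong (_∸ B) (2B+1≡B+[1+B] B)) (m+n∸m≡n B (suc B))) (∸-monoʳ-≤ (2 * B + 1) g≤B) ,
  subst (mirror B g ≤_) (m+n∸n≡m (2 * B) 1) (∸-monoʳ-≤ (2 * B + 1) 1≤g)

mirror-bounds⁻¹ : ∀ B {g} → B < g → g ≤ 2 * B → 1 ≤ mirror B g × mirror B g ≤ B
mirror-bounds⁻¹ B {g} B<g g≤2B =
  subst (_≤ mirror B g) (m+n∸m≡n (2 * B) 1) (∸-monoʳ-≤ (2 * B + 1) g≤2B) ,
  subst (mirror B g ≤_) (trans (cong (_∸ suc B) (2B+1≡B+[1+B] B)) (m+n∸n≡m B (suc B))) (∸-monoʳ-≤ (2 * B + 1) B<g)

mirror-involutive : ∀ B {g} → g ≤ 2 * B + 1 → mirror B (mirror B g) ≡ g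
mirror-involutive B = m∸[m∸n]≡n

module _ {B k : ℕ} (k<B : k < B) where
  private
    gap : ∃ λ c → suc k + c ≡ B
    gap = m≤n⇒∃[o]m+o≡n k<B

  mirror-reverse : mirror B (suc (B ∸ suc k)) ≡ suc (B + k)
  mirror-reverse with gap
  ... | c , refl = begin
    mirror (suc k + c) (suc (suc k + c ∸ suc k)) ≡⟨ cong (λ x → mirror (suc k + c) (suc x)) (m+n∸m≡n (suc k) c) ⟩
    2 * (suc k + c) + 1 ∸ suc c                  ≡⟨ cong (_∸ suc c) (split k c) ⟩
    suc c + suc (suc k + c + k) ∸ suc c          ≡⟨ m+n∸m≡n (suc c) _ ⟩
    suc (suc k + c + k)                          ∎
    where
    open ≡-Reasoning
    split : ∀ k c → 2 * (suc k + c) + 1 ≡ suc c + suc (suc k + c + k)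
    split = solve-∀

  double∸odd : 2 * B ∸ odd k ≡ odd (B ∸ suc k)
  double∸odd with gap
  ... | c , refl = begin
    2 * (suc k + c) ∸ odd k            ≡⟨ cong (_∸ odd k) (split k c) ⟩
    odd k + odd c ∸ odd k              ≡⟨ m+n∸m≡n (odd k) (odd c) ⟩
    odd c                              ≡⟨ cong odd (m+n∸m≡n (suc k) c) ⟨
    odd (suc k + c ∸ suc k)            ∎
    where
    open ≡-Reasoning
    split : ∀ k c → 2 * (suc k + c) ≡ suc (2 * k) + suc (2 * c)
    split = solve-∀

  ∣suc-mirror∣ : ∣ suc k - mirror B (suc k) ∣ ≡ odd (B ∸ suc k)
  ∣suc-mirror∣ with gap
  ... | c , refl = begin
    ∣ suc k - 2 * (suc k + c) + 1 ∸ suc k ∣  ≡⟨ cong (λ x → ∣ suc k - x ∸ suc k ∣) (split k c) ⟩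
    ∣ suc k - suc k + (suc k + odd c) ∸ suc k ∣ ≡⟨ cong ∣ suc k -_∣ (m+n∸m≡n (suc k) _) ⟩
    ∣ suc k - suc k + odd c ∣                ≡⟨ ∣m-m+n∣≡n (suc k) (odd c) ⟩
    odd c                                    ≡⟨ cong odd (m+n∸m≡n (suc k) c) ⟨
    odd (suc k + c ∸ suc k)                  ∎
    where
    open ≡-Reasoning
    split : ∀ k c → 2 * (suc k + c) + 1 ≡ suc k + (suc k + suc (2 * c))
    split = solve-∀

odd-mono-≤ : ∀ {m n} → m ≤ n → odd m ≤ odd n
odd-mono-≤ m≤n = s≤s (*-monoʳ-≤ 2 m≤n)

∑-odd⊓odd-reverse : ∀ C → ∑ (2 * C) (λ k → odd k ⊓ odd (2 * C ∸ suc k)) ≡ 2 * (C * C)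
∑-odd⊓odd-reverse C = begin
  ∑ (2 * C) f                                        ≡⟨ cong (λ b → ∑ b f) 2C≡C+C ⟩
  ∑ (C + C) f                                        ≡⟨ ∑-+ C C f ⟩
  ∑ C f + ∑ C (λ j → f (C + j))                      ≡⟨ cong₂ _+_ (∑-cong C lowerHalf) (∑-cong C upperHalf) ⟩
  ∑ C odd + ∑ C (λ j → odd (C ∸ suc j))              ≡⟨ cong (∑ C odd +_) (∑-reverse C odd) ⟨
  ∑ C odd + ∑ C odd                                  ≡⟨ cong (λ x → x + x) (∑-odd C) ⟩
  C * C + C * C                                      ≡⟨ cong (C * C +_) (+-identityʳ (C * C)) ⟨
  2 * (C * C)                                        ∎
  where
  open ≡-Reasoning
  f : ℕ → ℕ
  f k = odd k ⊓ odd (2 * C ∸ suc k)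
  2C≡C+C : 2 * C ≡ C + C
  2C≡C+C = cong (C +_) (+-identityʳ C)
  lowerHalf : ∀ k → k < C → f k ≡ odd k
  lowerHalf k k<C = m≤n⇒m⊓n≡m (odd-mono-≤ (≤-trans (<⇒≤ k<C) C≤))
    where
    C≤ : C ≤ 2 * C ∸ suc k
    C≤ = subst (_≤ 2 * C ∸ suc k) (trans (cong (_∸ C) 2C≡C+C) (m+n∸n≡m C C)) (∸-monoʳ-≤ (2 * C) k<C)
  upperHalf : ∀ j → j < C → f (C + j) ≡ odd (C ∸ suc j)
  upperHalf j _ = trans (cong (λ x → odd (C + j) ⊓ odd x) reflected) (m≥n⇒m⊓n≡n (odd-mono-≤ (≤-trans (m∸n≤m C (suc j)) (m≤m+n C j))))
    where
    reflected : 2 * C ∸ suc (C + j) ≡ C ∸ suc j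
    reflected = trans (cong₂ _∸_ 2C≡C+C (sym (+-suc C j))) ([m+n]∸[m+o]≡n∸o C C (suc j))

sum-map-+ : ∀ {A : Set} (f g : A → ℕ) xs → sum (map (λ x → f x + g x) xs) ≡ sum (map f xs) + sum (map g xs)
sum-map-+ f g []       = refl
sum-map-+ f g (x ∷ xs) = trans (cong (f x + g x +_) (sum-map-+ f g xs)) (interchange (f x) (g x) _ _)

sum-concatMap : ∀ {A : Set} (e : A → List ℕ) xs → sum (concatMap e xs) ≡ sum (map (λ x → sum (e x)) xs)
sum-concatMap e []       = refl
sum-concatMap e (x ∷ xs) = trans (sum-++ (e x) (concat (map e xs))) (cong (sum (e x) +_) (sum-concatMap e xs))

∑Q : (n : ℕ) → (Vertex n → ℕ) → ℕ
∑Q n h = sum (map h (allVertices n))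

∑Q-cong : ∀ n {g h : Vertex n → ℕ} → (∀ v → g v ≡ h v) → ∑Q n g ≡ ∑Q n h
∑Q-cong n eq = cong sum (map-cong eq (allVertices n))

∑Q-+ : ∀ n (g h : Vertex n → ℕ) → ∑Q n (λ v → g v + h v) ≡ ∑Q n g + ∑Q n h
∑Q-+ n g h = sum-map-+ g h (allVertices n)

∑Q-∷ : ∀ n h → ∑Q (suc n) h ≡ ∑Q n (λ w → h (false ∷ w)) + ∑Q n (λ w → h (true ∷ w))
∑Q-∷ n h = begin
  sum (map h (map (false ∷_) vs ++ map (true ∷_) vs))           ≡⟨ cong sum (map-++ h (map (false ∷_) vs) _) ⟩
  sum (map h (map (false ∷_) vs) ++ map h (map (true ∷_) vs))   ≡⟨ sum-++ (map h (map (false ∷_) vs)) _ ⟩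
  sum (map h (map (false ∷_) vs)) + sum (map h (map (true ∷_) vs))
    ≡⟨ cong₂ _+_ (cong sum (map-∘ vs)) (cong sum (map-∘ vs)) ⟨
  ∑Q n (λ w → h (false ∷ w)) + ∑Q n (λ w → h (true ∷ w))        ∎
  where
  open ≡-Reasoning
  vs = allVertices n

∑Q-∷ʳ : ∀ n h → ∑Q (suc n) h ≡ ∑Q n (λ w → h (w ∷ʳ false)) + ∑Q n (λ w → h (w ∷ʳ true))
∑Q-∷ʳ zero    h = cong (_+ (h (true ∷ []) + 0)) (sym (+-identityʳ (h (false ∷ []))))
∑Q-∷ʳ (suc n) h = begin
  ∑Q (suc (suc n)) h
    ≡⟨ ∑Q-∷ (suc n) h ⟩
  ∑Q (suc n) (λ w → h (false ∷ w)) + ∑Q (suc n) (λ w → h (true ∷ w))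
    ≡⟨ cong₂ _+_ (∑Q-∷ʳ n (λ w → h (false ∷ w))) (∑Q-∷ʳ n (λ w → h (true ∷ w))) ⟩
  (S false false + S false true) + (S true false + S true true)
    ≡⟨ interchange (S false false) (S false true) (S true false) (S true true) ⟩
  (S false false + S true false) + (S false true + S true true)
    ≡⟨ cong₂ _+_ (∑Q-∷ n (λ w → h (w ∷ʳ false))) (∑Q-∷ n (λ w → h (w ∷ʳ true))) ⟨
  ∑Q (suc n) (λ w → h (w ∷ʳ false)) + ∑Q (suc n) (λ w → h (w ∷ʳ true))
    ∎
  where
  open ≡-Reasoning
  S : Bool → Bool → ℕ
  S a b = ∑Q n (λ w → h (a ∷ (w ∷ʳ b)))

sum-tabulate-inject₁ : ∀ n (g : Fin (suc n) → ℕ) → sum (tabulate g) ≡ sum (tabulate (g ∘ inject₁)) + g (fromℕ n)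
sum-tabulate-inject₁ zero    g = +-comm (g Fin.zero) 0
sum-tabulate-inject₁ (suc n) g = trans (cong (g Fin.zero +_) (sum-tabulate-inject₁ n (g ∘ Fin.suc))) (sym (+-assoc (g Fin.zero) _ _))

module _ {A : Set} where
  lookup-∷ʳ-inject₁ : ∀ {n} (w : Vec A n) b i → lookup (w ∷ʳ b) (inject₁ i) ≡ lookup w i
  lookup-∷ʳ-inject₁ (x ∷ w) b Fin.zero    = refl
  lookup-∷ʳ-inject₁ (x ∷ w) b (Fin.suc i) = lookup-∷ʳ-inject₁ w b i

  lookup-∷ʳ-fromℕ : ∀ {n} (w : Vec A n) b → lookup (w ∷ʳ b) (fromℕ n) ≡ b
  lookup-∷ʳ-fromℕ []      b = refl
  lookup-∷ʳ-fromℕ (x ∷ w) b = lookup-∷ʳ-fromℕ w b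

  updateAt-∷ʳ-inject₁ : ∀ {n} (w : Vec A n) b i f → updateAt (w ∷ʳ b) (inject₁ i) f ≡ updateAt w i f ∷ʳ b
  updateAt-∷ʳ-inject₁ (x ∷ w) b Fin.zero    f = refl
  updateAt-∷ʳ-inject₁ (x ∷ w) b (Fin.suc i) f = cong (x ∷_) (updateAt-∷ʳ-inject₁ w b i f)

  updateAt-∷ʳ-fromℕ : ∀ {n} (w : Vec A n) b f → updateAt (w ∷ʳ b) (fromℕ n) f ≡ w ∷ʳ f b
  updateAt-∷ʳ-fromℕ []      b f = refl
  updateAt-∷ʳ-fromℕ (x ∷ w) b f = cong (x ∷_) (updateAt-∷ʳ-fromℕ w b f)

-- Wirelength for an arbitrary length function ℓ, so that the cyclic (ℓ = cycLen n) and the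
-- linear (ℓ = ∣_-_∣) wirelength obey one recurrence.
upwardLength : (n : ℕ) → (ℕ → ℕ → ℕ) → (Vertex n → ℕ) → Vertex n → ℕ
upwardLength n ℓ f v = sum (map (λ i → if lookup v i then 0 else ℓ (f v) (f (flipAt i v))) (allFin n))

wirelength : (n : ℕ) → (ℕ → ℕ → ℕ) → (Vertex n → ℕ) → ℕ
wirelength n ℓ f = ∑Q n (upwardLength n ℓ f)

cwlOf≡wirelength : ∀ n f → cwlOf n f ≡ wirelength n (cycLen n) f
cwlOf≡wirelength n f = sum-concatMap _ (allVertices n)

wirelength-cong : ∀ n {ℓ ℓ′ f f′} → (∀ v i → ℓ (f v) (f (flipAt i v)) ≡ ℓ′ (f′ v) (f′ (flipAt i v))) →
                  wirelength n ℓ f ≡ wirelength n ℓ′ f′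
wirelength-cong n eq = ∑Q-cong n (λ v → cong sum (map-cong (λ i → cong (if lookup v i then 0 else_) (eq v i)) (allFin n)))

upwardLength-∷ʳ : ∀ n ℓ f (w : Vertex n) b →
             upwardLength (suc n) ℓ f (w ∷ʳ b) ≡ upwardLength n ℓ (λ u → f (u ∷ʳ b)) w + (if b then 0 else ℓ (f (w ∷ʳ false)) (f (w ∷ʳ true)))
upwardLength-∷ʳ n ℓ f w b = begin
  sum (map g (allFin (suc n)))                 ≡⟨ cong sum (map-tabulate id g) ⟩
  sum (tabulate g)                             ≡⟨ sum-tabulate-inject₁ n g ⟩
  sum (tabulate (g ∘ inject₁)) + g (fromℕ n)   ≡⟨ cong (λ xs → sum xs + g (fromℕ n)) (map-tabulate id (g ∘ inject₁)) ⟨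
  sum (map (g ∘ inject₁) (allFin n)) + g (fromℕ n)
    ≡⟨ cong₂ _+_ (cong sum (map-cong earlierCoordinate (allFin n))) (lastCoordinate b) ⟩
  upwardLength n ℓ (λ u → f (u ∷ʳ b)) w + (if b then 0 else ℓ (f (w ∷ʳ false)) (f (w ∷ʳ true))) ∎
  where
  open ≡-Reasoning
  g : Fin (suc n) → ℕ
  g i = if lookup (w ∷ʳ b) i then 0 else ℓ (f (w ∷ʳ b)) (f (flipAt i (w ∷ʳ b)))
  earlierCoordinate : ∀ i → g (inject₁ i) ≡ (if lookup w i then 0 else ℓ (f (w ∷ʳ b)) (f (flipAt i w ∷ʳ b)))
  earlierCoordinate i rewrite lookup-∷ʳ-inject₁ w b i | updateAt-∷ʳ-inject₁ w b i not = refl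
  lastCoordinate : ∀ b → (if lookup (w ∷ʳ b) (fromℕ n) then 0 else ℓ (f (w ∷ʳ b)) (f (flipAt (fromℕ n) (w ∷ʳ b))))
                         ≡ (if b then 0 else ℓ (f (w ∷ʳ false)) (f (w ∷ʳ true)))
  lastCoordinate b rewrite lookup-∷ʳ-fromℕ w b | updateAt-∷ʳ-fromℕ w b not with b
  ... | false = refl
  ... | true  = refl

wirelength-∷ʳ : ∀ n ℓ f → wirelength (suc n) ℓ f ≡
                wirelength n ℓ (λ u → f (u ∷ʳ false)) + wirelength n ℓ (λ u → f (u ∷ʳ true))
                  + ∑Q n (λ w → ℓ (f (w ∷ʳ false)) (f (w ∷ʳ true)))
wirelength-∷ʳ n ℓ f = begin
  wirelength (suc n) ℓ f
    ≡⟨ ∑Q-∷ʳ n (upwardLength (suc n) ℓ f) ⟩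
  ∑Q n (λ w → upwardLength (suc n) ℓ f (w ∷ʳ false)) + ∑Q n (λ w → upwardLength (suc n) ℓ f (w ∷ʳ true))
    ≡⟨ cong₂ _+_ (∑Q-cong n (λ w → upwardLength-∷ʳ n ℓ f w false))
                 (∑Q-cong n (λ w → trans (upwardLength-∷ʳ n ℓ f w true) (+-identityʳ _))) ⟩
  ∑Q n (λ w → upwardLength n ℓ f₀ w + cross w) + wirelength n ℓ f₁
    ≡⟨ cong (_+ wirelength n ℓ f₁) (∑Q-+ n (upwardLength n ℓ f₀) cross) ⟩
  wirelength n ℓ f₀ + ∑Q n cross + wirelength n ℓ f₁
    ≡⟨ xy∙z≈xz∙y (wirelength n ℓ f₀) _ _ ⟩
  wirelength n ℓ f₀ + wirelength n ℓ f₁ + ∑Q n cross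
    ∎
  where
  open ≡-Reasoning
  f₀ f₁ : Vertex n → ℕ
  f₀ u = f (u ∷ʳ false)
  f₁ u = f (u ∷ʳ true)
  cross : Vertex n → ℕ
  cross w = ℓ (f (w ∷ʳ false)) (f (w ∷ʳ true))

[m%d+n]%d≡[m+n]%d : ∀ m n d .{{_ : NonZero d}} → (m % d + n) % d ≡ (m + n) % d
[m%d+n]%d≡[m+n]%d m n d = begin
  (m % d + n) % d             ≡⟨ %-distribˡ-+ (m % d) n d ⟩
  (m % d % d + n % d) % d     ≡⟨ cong (λ z → (z + n % d) % d) (m%n%n≡m%n m d) ⟩
  (m % d + n % d) % d         ≡⟨ %-distribˡ-+ m n d ⟨
  (m + n) % d                 ∎
  where open ≡-Reasoning

[x%N+N∸y%N]%N≡e%N : ∀ {N} .{{_ : NonZero N}} x y e → (y + e) % N ≡ x % N → (x % N + N ∸ y % N) % N ≡ e % N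
[x%N+N∸y%N]%N≡e%N {N} x y e y+e≡x = begin
  (x % N + N ∸ y % N) % N         ≡⟨ cong (λ z → (z + N ∸ y % N) % N) y+e≡x ⟨
  ((y + e) % N + N ∸ y % N) % N   ≡⟨ cong (_% N) (+-∸-assoc ((y + e) % N) (m%n≤n y N)) ⟩
  ((y + e) % N + (N ∸ y % N)) % N ≡⟨ [m%d+n]%d≡[m+n]%d (y + e) (N ∸ y % N) N ⟩
  (y + e + (N ∸ y % N)) % N       ≡⟨ cong (_% N) unfold ⟩
  (e + suc (y / N) * N) % N       ≡⟨ [m+kn]%n≡m%n e (suc (y / N)) N ⟩
  e % N                           ∎
  where
  open ≡-Reasoning
  rearrange : ∀ r q N e t → r + q * N + e + t ≡ e + (r + t + q * N)
  rearrange = solve-∀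
  unfold : y + e + (N ∸ y % N) ≡ e + suc (y / N) * N
  unfold = begin
    y + e + (N ∸ y % N)                          ≡⟨ cong (λ z → z + e + (N ∸ y % N)) (m≡m%n+[m/n]*n y N) ⟩
    y % N + y / N * N + e + (N ∸ y % N)          ≡⟨ rearrange (y % N) (y / N) N e _ ⟩
    e + (y % N + (N ∸ y % N) + y / N * N)        ≡⟨ cong (λ z → e + (z + y / N * N)) (m+[n∸m]≡n (m%n≤n y N)) ⟩
    e + suc (y / N) * N                          ∎

module _ (m : ℕ) where
  private instance
    2^m≢0 : NonZero (2 ^ m)
    2^m≢0 = m^n≢0 2 m

  cycLen≡ : ∀ x y → ∣ x - y ∣ < 2 ^ m → cycLen m x y ≡ ∣ x - y ∣ ⊓ (2 ^ m ∸ ∣ x - y ∣)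
  cycLen≡ x y d<N with ≤-total y x
  ... | inj₁ y≤x with m≤n⇒∃[o]m+o≡n y≤x
  ...   | d , refl rewrite ∣-∣-comm (y + d) y | ∣m-m+n∣≡n y d =
    cong (λ a → a ⊓ (2 ^ m ∸ a)) (trans ([x%N+N∸y%N]%N≡e%N (y + d) y d refl) (m<n⇒m%n≡m d<N))
  cycLen≡ x y d<N | inj₂ x≤y with m≤n⇒∃[o]m+o≡n x≤y
  ...   | d , refl rewrite ∣m-m+n∣≡n x d =
    trans (cong (λ a → a ⊓ (2 ^ m ∸ a)) ([x%N+N∸y%N]%N≡e%N x (x + d) (2 ^ m ∸ d) wraps)) (complement d d<N)
    where
    wraps : (x + d + (2 ^ m ∸ d)) % 2 ^ m ≡ x % 2 ^ m
    wraps = trans (cong (_% 2 ^ m) (trans (+-assoc x d _) (cong (x +_) (m+[n∸m]≡n (<⇒≤ d<N))))) ([m+n]%n≡m%n x (2 ^ m))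
    complement : ∀ d → d < 2 ^ m → ((2 ^ m ∸ d) % 2 ^ m) ⊓ (2 ^ m ∸ (2 ^ m ∸ d) % 2 ^ m) ≡ d ⊓ (2 ^ m ∸ d)
    complement zero    _   rewrite n%n≡0 (2 ^ m) {{2^m≢0}} = refl
    complement (suc d) d<N rewrite m<n⇒m%n≡m (∸-monoʳ-< {2 ^ m} {suc d} {0} (s≤s z≤n) (<⇒≤ d<N)) | m∸[m∸n]≡n (<⇒≤ d<N) =
      ⊓-comm (2 ^ m ∸ suc d) (suc d)

∣m-n∣≤o : ∀ {m n o} → m ≤ o → n ≤ o → ∣ m - n ∣ ≤ o
∣m-n∣≤o {m} {n} m≤o n≤o = ≤-trans (∣m-n∣≤m⊔n m n) (⊔-lub m≤o n≤o)

cycLen-short : ∀ n x y → ∣ x - y ∣ ≤ 2 ^ n → cycLen (suc n) x y ≡ ∣ x - y ∣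
cycLen-short n x y d≤B = trans (cycLen≡ (suc n) x y d<2B) (m≤n⇒m⊓n≡m d≤2B∸d)
  where
  B = 2 ^ n
  2B∸B≡B : 2 * B ∸ B ≡ B
  2B∸B≡B = trans (m+n∸m≡n B (B + 0)) (+-identityʳ B)
  d<2B : ∣ x - y ∣ < 2 * B
  d<2B = ≤-<-trans d≤B (m<m+n B (subst (0 <_) (sym (+-identityʳ B)) (m^n>0 2 n)))
  d≤2B∸d : ∣ x - y ∣ ≤ 2 * B ∸ ∣ x - y ∣
  d≤2B∸d = ≤-trans d≤B (subst (_≤ 2 * B ∸ ∣ x - y ∣) 2B∸B≡B (∸-monoʳ-≤ (2 * B) d≤B))

cycLen-suc : ∀ m {x y} → x < 2 ^ m → y < 2 ^ m → cycLen m (suc x) (suc y) ≡ cycLen m x y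
cycLen-suc m {x} {y} x<N y<N = trans (cycLen≡ m (suc x) (suc y) d<N) (sym (cycLen≡ m x y d<N))
  where
  d<N : ∣ x - y ∣ < 2 ^ m
  d<N = ≤-<-trans (∣m-n∣≤m⊔n x y) (⊔-lub x<N y<N)

gray-∷ʳ : ∀ n (w : Vertex n) b → gray (suc n) (w ∷ʳ b) ≡ (if b then mirror (2 ^ n) (gray n w) else gray n w)
gray-∷ʳ n w b rewrite last-∷ʳ b w | init-∷ʳ b w = refl

gray-bounds : ∀ n v → 1 ≤ gray n v × gray n v ≤ 2 ^ n
gray-bounds zero    v = s≤s z≤n , s≤s z≤n
gray-bounds (suc n) v with initLast v
... | w , b , refl with b | gray-bounds n w
...   | false | 1≤g , g≤B = 1≤g , ≤-trans g≤B (m≤m+n (2 ^ n) _)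
...   | true  | 1≤g , g≤B with mirror-bounds (2 ^ n) 1≤g g≤B
...     | B<g′ , g′≤2B = ≤-trans (s≤s z≤n) B<g′ , g′≤2B

gray≤2*2^n+1 : ∀ n v → gray n v ≤ 2 * 2 ^ n + 1
gray≤2*2^n+1 n v = ≤-trans (proj₂ (gray-bounds n v)) (≤-trans (m≤m+n (2 ^ n) _) (m≤m+n _ 1))

∣gray-gray∣≤ : ∀ n (v u : Vertex n) → ∣ gray n v - gray n u ∣ ≤ 2 ^ n
∣gray-gray∣≤ n v u = ∣m-n∣≤o (proj₂ (gray-bounds n v)) (proj₂ (gray-bounds n u))

∣gray-∷ʳ-gray-∷ʳ∣ : ∀ n b (v u : Vertex n) → ∣ gray (suc n) (v ∷ʳ b) - gray (suc n) (u ∷ʳ b) ∣ ≡ ∣ gray n v - gray n u ∣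
∣gray-∷ʳ-gray-∷ʳ∣ n b v u rewrite gray-∷ʳ n v b | gray-∷ʳ n u b with b
... | false = refl
... | true  = ∣∸-∸∣ (gray≤2*2^n+1 n v) (gray≤2*2^n+1 n u)

∑Q-gray : ∀ n h → ∑Q n (λ w → h (gray n w)) ≡ ∑ (2 ^ n) (λ k → h (suc k))
∑Q-gray zero    h = +-comm (h 1) 0
∑Q-gray (suc n) h = begin
  ∑Q (suc n) (λ w → h (gray (suc n) w))
    ≡⟨ ∑Q-∷ʳ n (λ w → h (gray (suc n) w)) ⟩
  ∑Q n (λ w → h (gray (suc n) (w ∷ʳ false))) + ∑Q n (λ w → h (gray (suc n) (w ∷ʳ true)))
    ≡⟨ cong₂ _+_ (copy false) (copy true) ⟩
  ∑Q n (λ w → h (gray n w)) + ∑Q n (λ w → h (mirror B (gray n w)))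
    ≡⟨ cong₂ _+_ (∑Q-gray n h) (∑Q-gray n (λ x → h (mirror B x))) ⟩
  ∑ B (λ k → h (suc k)) + ∑ B (λ k → h (mirror B (suc k)))
    ≡⟨ cong (∑ B (λ k → h (suc k)) +_) (∑-reverse B (λ k → h (mirror B (suc k)))) ⟩
  ∑ B (λ k → h (suc k)) + ∑ B (λ k → h (mirror B (suc (B ∸ suc k))))
    ≡⟨ cong (∑ B (λ k → h (suc k)) +_) (∑-cong B (λ k k<B → cong h (mirror-reverse k<B))) ⟩
  ∑ B (λ k → h (suc k)) + ∑ B (λ k → h (suc (B + k)))
    ≡⟨ ∑-+ B B (λ k → h (suc k)) ⟨
  ∑ (B + B) (λ k → h (suc k))
    ≡⟨ cong (λ b → ∑ (B + b) (λ k → h (suc k))) (+-identityʳ B) ⟨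
  ∑ (2 ^ suc n) (λ k → h (suc k))
    ∎
  where
  open ≡-Reasoning
  B = 2 ^ n
  copy : ∀ b → ∑Q n (λ w → h (gray (suc n) (w ∷ʳ b))) ≡ ∑Q n (λ w → h (if b then mirror B (gray n w) else gray n w))
  copy b = ∑Q-cong n (λ w → cong h (gray-∷ʳ n w b))

wlGray : ℕ → ℕ
wlGray n = wirelength n ∣_-_∣ (gray n)

wirelength-gray-∷ʳ : ∀ n ℓ →
  (∀ b (v u : Vertex n) → ℓ (gray (suc n) (v ∷ʳ b)) (gray (suc n) (u ∷ʳ b)) ≡ ∣ gray n v - gray n u ∣) →
  wirelength (suc n) ℓ (gray (suc n)) ≡ 2 * wlGray n + ∑Q n (λ w → ℓ (gray n w) (mirror (2 ^ n) (gray n w)))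
wirelength-gray-∷ʳ n ℓ linearInCopies = begin
  wirelength (suc n) ℓ (gray (suc n))
    ≡⟨ wirelength-∷ʳ n ℓ (gray (suc n)) ⟩
  copy false + copy true + crossing
    ≡⟨ cong₂ (λ a b → a + b + crossing) (copy≡ false) (copy≡ true) ⟩
  wlGray n + wlGray n + crossing
    ≡⟨ cong (λ a → wlGray n + a + crossing) (+-identityʳ (wlGray n)) ⟨
  2 * wlGray n + crossing
    ≡⟨ cong (2 * wlGray n +_) (∑Q-cong n (λ w → cong₂ ℓ (gray-∷ʳ n w false) (gray-∷ʳ n w true))) ⟩
  2 * wlGray n + ∑Q n (λ w → ℓ (gray n w) (mirror (2 ^ n) (gray n w)))
    ∎
  where
  open ≡-Reasoning
  crossing : ℕ
  crossing = ∑Q n (λ w → ℓ (gray (suc n) (w ∷ʳ false)) (gray (suc n) (w ∷ʳ true)))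
  copy : Bool → ℕ
  copy b = wirelength n ℓ (λ u → gray (suc n) (u ∷ʳ b))
  copy≡ : ∀ b → copy b ≡ wlGray n
  copy≡ b = wirelength-cong n {ℓ} {∣_-_∣} {λ u → gray (suc n) (u ∷ʳ b)} {gray n} (λ v i → linearInCopies b v (flipAt i v))

wlGray-suc : ∀ n → wlGray (suc n) ≡ 2 * wlGray n + 2 ^ n * 2 ^ n
wlGray-suc n = trans (wirelength-gray-∷ʳ n ∣_-_∣ (∣gray-∷ʳ-gray-∷ʳ∣ n)) (cong (2 * wlGray n +_) crossing)
  where
  open ≡-Reasoning
  B = 2 ^ n
  crossing : ∑Q n (λ w → ∣ gray n w - mirror B (gray n w) ∣) ≡ B * B
  crossing = begin
    ∑Q n (λ w → ∣ gray n w - mirror B (gray n w) ∣) ≡⟨ ∑Q-gray n (λ x → ∣ x - mirror B x ∣) ⟩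
    ∑ B (λ k → ∣ suc k - mirror B (suc k) ∣)        ≡⟨ ∑-cong B (λ k k<B → ∣suc-mirror∣ k<B) ⟩
    ∑ B (λ k → odd (B ∸ suc k))                     ≡⟨ ∑-reverse B odd ⟨
    ∑ B odd                                         ≡⟨ ∑-odd B ⟩
    B * B                                           ∎

wlGray-closed : ∀ n → 2 * wlGray n + 2 ^ n ≡ 2 ^ n * 2 ^ n
wlGray-closed zero    = refl
wlGray-closed (suc n) = begin
  2 * wlGray (suc n) + 2 ^ suc n             ≡⟨ cong (λ x → 2 * x + 2 ^ suc n) (wlGray-suc n) ⟩
  2 * (2 * wlGray n + B * B) + 2 * B         ≡⟨ regroup (wlGray n) B ⟩
  2 * (2 * wlGray n + B) + 2 * (B * B)       ≡⟨ cong (λ x → 2 * x + 2 * (B * B)) (wlGray-closed n) ⟩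
  2 * (B * B) + 2 * (B * B)                  ≡⟨ square-double B ⟩
  2 * B * (2 * B)                            ∎
  where
  open ≡-Reasoning
  B = 2 ^ n
  regroup : ∀ L B → 2 * (2 * L + B * B) + 2 * B ≡ 2 * (2 * L + B) + 2 * (B * B)
  regroup = solve-∀
  square-double : ∀ B → 2 * (B * B) + 2 * (B * B) ≡ 2 * B * (2 * B)
  square-double = solve-∀

odd<double : ∀ {j B} → j < B → odd j < 2 * B
odd<double {j} {B} j<B = subst (_≤ 2 * B) (cong suc (+-suc j (j + 0))) (*-monoʳ-≤ 2 j<B)

cycLen-suc-mirror : ∀ n {k} → k < 2 ^ n → cycLen (suc n) (suc k) (mirror (2 ^ n) (suc k)) ≡ odd k ⊓ odd (2 ^ n ∸ suc k)
cycLen-suc-mirror n {k} k<B = begin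
  cycLen (suc n) (suc k) (mirror B (suc k))   ≡⟨ cycLen≡ (suc n) _ _ (subst (_< 2 * B) (sym (∣suc-mirror∣ k<B)) (odd<double j<B)) ⟩
  d ⊓ (2 * B ∸ d)                             ≡⟨ cong (λ x → x ⊓ (2 * B ∸ x)) (∣suc-mirror∣ k<B) ⟩
  odd j ⊓ (2 * B ∸ odd j)                     ≡⟨ cong (odd j ⊓_) (double∸odd j<B) ⟩
  odd j ⊓ odd (B ∸ suc j)                     ≡⟨ cong (λ x → odd j ⊓ odd x) reverse-involutive ⟩
  odd j ⊓ odd k                               ≡⟨ ⊓-comm (odd j) (odd k) ⟩
  odd k ⊓ odd j                               ∎
  where
  open ≡-Reasoning
  B = 2 ^ n
  d = ∣ suc k - mirror B (suc k) ∣
  j = B ∸ suc k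
  j<B : j < B
  j<B = ∸-monoʳ-< {B} {suc k} {0} (s≤s z≤n) k<B
  reverse-involutive : B ∸ suc j ≡ k
  reverse-involutive = trans (sym (pred[m∸n]≡m∸[1+n] B j)) (cong pred (m∸[m∸n]≡n k<B))

cwlGray-suc : ∀ n → cwlGray (suc n) ≡ 2 * wlGray n + ∑Q n (λ w → cycLen (suc n) (gray n w) (mirror (2 ^ n) (gray n w)))
cwlGray-suc n = trans (cwlOf≡wirelength (suc n) (gray (suc n))) (wirelength-gray-∷ʳ n (cycLen (suc n)) shortInCopies)
  where
  shortInCopies : ∀ b (v u : Vertex n) → cycLen (suc n) (gray (suc n) (v ∷ʳ b)) (gray (suc n) (u ∷ʳ b)) ≡ ∣ gray n v - gray n u ∣
  shortInCopies b v u = trans (cycLen-short n _ _ (subst (_≤ 2 ^ n) (sym sameDistance) (∣gray-gray∣≤ n v u))) sameDistance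
    where
    sameDistance = ∣gray-∷ʳ-gray-∷ʳ∣ n b v u

crossing-cyclic : ∀ n → ∑Q (suc n) (λ w → cycLen (suc (suc n)) (gray (suc n) w) (mirror (2 ^ suc n) (gray (suc n) w)))
                        ≡ 2 * (2 ^ n * 2 ^ n)
crossing-cyclic n = begin
  ∑Q (suc n) (λ w → cycLen (suc (suc n)) (gray (suc n) w) (mirror B (gray (suc n) w)))
    ≡⟨ ∑Q-gray (suc n) (λ x → cycLen (suc (suc n)) x (mirror B x)) ⟩
  ∑ B (λ k → cycLen (suc (suc n)) (suc k) (mirror B (suc k)))
    ≡⟨ ∑-cong B (λ k → cycLen-suc-mirror (suc n)) ⟩
  ∑ B (λ k → odd k ⊓ odd (B ∸ suc k))
    ≡⟨ ∑-odd⊓odd-reverse (2 ^ n) ⟩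
  2 * (2 ^ n * 2 ^ n)
    ∎
  where
  open ≡-Reasoning
  B = 2 ^ suc n

2^[2*m]≡2^m*2^m : ∀ m → 2 ^ (2 * m) ≡ 2 ^ m * 2 ^ m
2^[2*m]≡2^m*2^m m = trans (cong (λ e → 2 ^ (m + e)) (+-identityʳ m)) (^-distribˡ-+-* 2 m m)

cwlGray-closed : ∀ n → cwlGray (suc (suc n)) ≡ 2 ^ (2 * suc (suc n) ∸ 2) + 2 ^ (2 * suc (suc n) ∸ 3) ∸ 2 ^ (suc (suc n) ∸ 1)
cwlGray-closed n = begin
  cwlGray (suc (suc n))                       ≡⟨ trans (cwlGray-suc (suc n)) (cong (2 * W +_) (crossing-cyclic n)) ⟩
  2 * W + 2 * (C * C)                         ≡⟨ m+n∸n≡m _ B ⟨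
  2 * W + 2 * (C * C) + B ∸ B                 ≡⟨ cong (_∸ B) (xy∙z≈xz∙y (2 * W) _ B) ⟩
  2 * W + B + 2 * (C * C) ∸ B                 ≡⟨ cong (λ x → x + 2 * (C * C) ∸ B) (wlGray-closed (suc n)) ⟩
  B * B + 2 * (C * C) ∸ B                     ≡⟨ cong₂ (λ x y → x + y ∸ B) (2^[2*m]≡2^m*2^m (suc n)) (cong (2 *_) (2^[2*m]≡2^m*2^m n)) ⟨
  2 ^ (2 * suc n) + 2 ^ suc (2 * n) ∸ B       ≡⟨ cong₂ (λ x y → 2 ^ x + 2 ^ y ∸ B) twice-minus-2 twice-minus-3 ⟨
  2 ^ (2 * suc (suc n) ∸ 2) + 2 ^ (2 * suc (suc n) ∸ 3) ∸ 2 ^ (suc (suc n) ∸ 1) ∎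
  where
  open ≡-Reasoning
  W = wlGray (suc n)
  B = 2 ^ suc n
  C = 2 ^ n
  twice-minus-2 : 2 * suc (suc n) ∸ 2 ≡ 2 * suc n
  twice-minus-2 = sym (*-distribˡ-∸ 2 (suc (suc n)) 1)
  twice-minus-3 : 2 * suc (suc n) ∸ 3 ≡ suc (2 * n)
  twice-minus-3 = trans (cong (_∸ 1) twice-minus-2) (+-suc n (n + 0))

grayVertex : (n : ℕ) → ℕ → Vertex n
grayVertex zero    k = []
grayVertex (suc n) k with k ≤? 2 ^ n
... | yes _ = grayVertex n k ∷ʳ false
... | no  _ = grayVertex n (mirror (2 ^ n) k) ∷ʳ true

grayVertex-gray : ∀ n (v : Vertex n) → grayVertex n (gray n v) ≡ v
grayVertex-gray zero    []  = refl
grayVertex-gray (suc n) v with initLast v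
... | w , false , refl with gray n w ≤? 2 ^ n
...   | yes _   = cong (_∷ʳ false) (grayVertex-gray n w)
...   | no  g≰B = contradiction (proj₂ (gray-bounds n w)) g≰B
grayVertex-gray (suc n) v | w , true , refl with mirror (2 ^ n) (gray n w) ≤? 2 ^ n
...   | yes g′≤B = contradiction g′≤B (<⇒≱ (proj₁ (uncurry (mirror-bounds (2 ^ n)) (gray-bounds n w))))
...   | no  _    = cong (_∷ʳ true) (trans (cong (grayVertex n) (mirror-involutive (2 ^ n) (gray≤2*2^n+1 n w))) (grayVertex-gray n w))

gray-grayVertex : ∀ n {k} → 1 ≤ k → k ≤ 2 ^ n → gray n (grayVertex n k) ≡ k
gray-grayVertex zero    (s≤s z≤n) (s≤s z≤n) = refl
gray-grayVertex (suc n) {k} 1≤k k≤2B with k ≤? 2 ^ n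
... | yes k≤B = trans (gray-∷ʳ n (grayVertex n k) false) (gray-grayVertex n 1≤k k≤B)
... | no  k≰B = begin
  gray (suc n) (grayVertex n (mirror B k) ∷ʳ true) ≡⟨ gray-∷ʳ n (grayVertex n (mirror B k)) true ⟩
  mirror B (gray n (grayVertex n (mirror B k)))    ≡⟨ cong (mirror B) (uncurry (gray-grayVertex n) (mirror-bounds⁻¹ B (≰⇒> k≰B) k≤2B)) ⟩
  mirror B (mirror B k)                            ≡⟨ mirror-involutive B (≤-trans k≤2B (m≤m+n (2 * B) 1)) ⟩
  k                                                ∎
  where
  open ≡-Reasoning
  B = 2 ^ n

grayPosition : ∀ n → Vertex n → Fin (2 ^ n)
grayPosition n v = fromℕ< (pred-gray<2^n n v)
  where
  pred-gray<2^n : ∀ n v → pred (gray n v) < 2 ^ n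
  pred-gray<2^n n v with gray-bounds n v
  ... | 1≤g , g≤N = subst (_≤ 2 ^ n) (sym (suc-pred (gray n v) {{>-nonZero 1≤g}})) g≤N

suc-grayPosition : ∀ n v → suc (toℕ (grayPosition n v)) ≡ gray n v
suc-grayPosition n v = trans (cong suc (toℕ-fromℕ< _)) (suc-pred (gray n v) {{>-nonZero (proj₁ (gray-bounds n v))}})

grayNumbering : ∀ n → Numbering n
grayNumbering n = mk⤖ {to = grayPosition n} (injective , surjective)
  where
  injective : ∀ {v u} → grayPosition n v ≡ grayPosition n u → v ≡ u
  injective {v} {u} eq = begin
    v                          ≡⟨ grayVertex-gray n v ⟨
    grayVertex n (gray n v)    ≡⟨ cong (grayVertex n) sameGray ⟩
    grayVertex n (gray n u)    ≡⟨ grayVertex-gray n u ⟩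
    u                          ∎
    where
    open ≡-Reasoning
    sameGray : gray n v ≡ gray n u
    sameGray = trans (sym (suc-grayPosition n v)) (trans (cong (suc ∘ toℕ) eq) (suc-grayPosition n u))
  surjective : ∀ p → ∃ λ v → ∀ {u} → u ≡ v → grayPosition n u ≡ p
  surjective p = grayVertex n (suc (toℕ p)) , λ { refl → toℕ-injective (suc-injective
    (trans (suc-grayPosition n _) (gray-grayVertex n (s≤s z≤n) (toℕ<n p)))) }

cwl-grayNumbering : ∀ n → cwl n (grayNumbering n) ≡ cwlGray n
cwl-grayNumbering n = trans (cwlOf≡wirelength n _) (trans (wirelength-cong n {cycLen n} {cycLen n} {toℕ ∘ grayPosition n} {gray n} shift) (sym (cwlOf≡wirelength n (gray n))))
  where
  shift : ∀ v i → cycLen n (toℕ (grayPosition n v)) (toℕ (grayPosition n (flipAt i v)))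
                ≡ cycLen n (gray n v) (gray n (flipAt i v))
  shift v i = trans (sym (cycLen-suc n (toℕ<n _) (toℕ<n _))) (cong₂ (cycLen n) (suc-grayPosition n v) (suc-grayPosition n (flipAt i v)))

mainTheorem3 : (n : ℕ) → 2 ≤ n →
    ((η : Numbering n) → cwlGray n ≤ cwl n η) →
    IsCwl n (2 ^ (2 * n ∸ 2) + 2 ^ (2 * n ∸ 3) ∸ 2 ^ (n ∸ 1))
mainTheorem3 (suc (suc n)) (s≤s (s≤s z≤n)) grayIsOptimal =
  (grayNumbering (suc (suc n)) , trans (cwl-grayNumbering (suc (suc n))) (cwlGray-closed n)) ,
  λ η → subst (_≤ cwl (suc (suc n)) η) (cwlGray-closed n) (grayIsOptimal η)
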